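{- Let $G=(V,E)$ be a directed acyclic graph with $n$ vertices and $m$ edges, and let $\Gamma_1$ be a path-based hierarchical drawing of $G$. The compaction algorithm, which visits the vertices in increasing order of their $y$-coordinates in $\Gamma_1$ and assigns to each vertex $v$ the new coordinate $y(v)=0$ if $v$ has no incoming edges and $y(v)=1+\max\{y(w):(w,v)\in E\}$ otherwise (keeping $x$-coordinates unchanged), runs in $O(n+m)$ time and produces a path-based hierarchical drawing $\Gamma_2$ of $G$ whose height equals $L$, the length (number of edges) of a longest directed path in $G$.
   Context: A path-based hierarchical drawing of a DAG $G$ is obtained from a path decomposition $\{P_1,\dots,P_k\}$ of $G$ (vertex-disjoint directed paths covering all vertices): the vertices of each path $P_i$ are drawn vertically aligned on an $x$-coordinate determined by the order of $P_i$, and each vertex receives as $y$-coordinate its position in a topological sorting of $G$ (so the height of $\Gamma_1$ is $n-1$). Every edge goes from a vertex with lower $y$-coordinate to one with higher $y$-coordinate. The height of a drawing is the difference between the largest and smallest $y$-coordinates of its vertices. -}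

module Defs where

open import Data.Nat using (ℕ; zero; suc; _+_; _∸_; _≤_; _<_; _⊔_)
open import Data.Fin using (Fin; toℕ; _≟_)
open import Data.Fin.Permutation using (Permutation′; _⟨$⟩ʳ_; _⟨$⟩ˡ_)
open import Data.List using (List; []; _∷_; length; map; foldr; foldl; allFin)
open import Data.Nat.ListAction using (sum)
open import Data.List.Membership.Propositional using (_∈_)
open import Data.List.Relation.Unary.Linked using (Linked)
open import Data.List.Relation.Unary.Unique.Propositional using (Unique)
open import Data.Product using (Σ; ∃; ∃-syntax; _×_; _,_; proj₁; proj₂)
open import Data.Empty using (⊥)
open import Relation.Nullary using (¬_; yes; no)
open import Relation.Binary.PropositionalEquality using (_≡_)
open import Relation.Binary.Construct.Closure.Transitive using (TransClosure)

-- Directed graphs on vertex set Fin n, given by incoming adjacency lists: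
-- w ∈ inc v  iff  (w , v) ∈ E.  (This is the standard adjacency-list
-- input representation assumed for linear-time graph algorithms.)

record DAG (n : ℕ) : Set where
  field
    inc       : Fin n → List (Fin n)
    inc-set   : ∀ v → Unique (inc v)
  Edge : Fin n → Fin n → Set
  Edge w v = w ∈ inc v
  field
    acyclic   : ∀ v → ¬ TransClosure Edge v v

open DAG public

edgeCount : ∀ {n} → DAG n → ℕ
edgeCount {n} G = sum (map (λ v → length (inc G v)) (allFin n))

record DirectedPath {n} (G : DAG n) : Set where
  field
    vertices : List (Fin n)
    nonempty : ¬ (vertices ≡ [])
    linked   : Linked (Edge G) vertices
    simple   : Unique vertices

pathLength : ∀ {n} {G : DAG n} → DirectedPath G → ℕ
pathLength P = length (DirectedPath.vertices P) ∸ 1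

IsLongestPathLength : ∀ {n} → DAG n → ℕ → Set
IsLongestPathLength G L =
  (Σ (DirectedPath G) λ P → pathLength P ≡ L) ×
  (∀ (P : DirectedPath G) → pathLength P ≤ L)

record PathDecomposition {n} (G : DAG n) : Set where
  field
    k        : ℕ
    path     : Fin k → DirectedPath G
    covers   : ∀ v → ∃[ i ] (v ∈ DirectedPath.vertices (path i))
    disjoint : ∀ v i j → v ∈ DirectedPath.vertices (path i)
                       → v ∈ DirectedPath.vertices (path j) → i ≡ j

-- Path-based hierarchical drawings: a drawing is a pair of coordinate
-- functions (x , y).

record IsPathBasedDrawing {n} (G : DAG n) (D : PathDecomposition G)
                          (x y : Fin n → ℕ) : Set where
  field
    x-path  : ∀ v (i : Fin (PathDecomposition.k D)) →
              v ∈ DirectedPath.vertices (PathDecomposition.path D i) →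
              x v ≡ toℕ i
    upward  : ∀ w v → Edge G w v → y w < y v

-- y-coordinates given by a topological sorting, presented as a
-- permutation π : V → {0,…,n-1} (the position of each vertex)
sortY : ∀ {n} → Permutation′ n → Fin n → ℕ
sortY π v = toℕ (π ⟨$⟩ʳ v)

Height : ∀ {n} → (Fin n → ℕ) → ℕ → Set
Height {n} y h = ∃[ lo ] ∃[ hi ] ((∀ w → y lo ≤ y w) × (∀ w → y w ≤ y hi)
                                  × h ≡ y hi ∸ y lo)

-- The compaction algorithm, instrumented with a step counter.
-- State: current table of new y-coordinates and elapsed steps.
-- Visiting vertex v costs one step for the visit plus one step per
-- incoming edge inspected.

maxList : List ℕ → ℕ
maxList = foldr _⊔_ 0

newY : ∀ {n} → (Fin n → ℕ) → List (Fin n) → ℕ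
newY tbl []       = 0
newY tbl (w ∷ ws) = suc (maxList (map tbl (w ∷ ws)))

update : ∀ {n} → (Fin n → ℕ) → Fin n → ℕ → Fin n → ℕ
update tbl v a u with u ≟ v
... | yes _ = a
... | no  _ = tbl u

visit : ∀ {n} → DAG n → (Fin n → ℕ) × ℕ → Fin n → (Fin n → ℕ) × ℕ
visit G (tbl , t) v =
  update tbl v (newY tbl (inc G v)) , t + suc (length (inc G v))

visitOrder : ∀ {n} → Permutation′ n → List (Fin n)
visitOrder {n} π = map (π ⟨$⟩ˡ_) (allFin n)

compact : ∀ {n} → DAG n → Permutation′ n → (Fin n → ℕ) × ℕ
compact G π = foldl (visit G) ((λ _ → 0) , 0) (visitOrder π)

{-# OPTIONS --safe #-}
module Submission where

-- Call f a compacted drawing when f v = 0 for sources and f v = 1 + max of f over the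
-- in-neighbours otherwise. Visiting the vertices in a topological order, every in-neighbour of v
-- already has its final value when v is assigned, so the algorithm outputs a compacted f, in
-- n + m steps. For a compacted f, edges go up, so f rises by at least one per edge of any path;
-- conversely, walking back from v along maximising in-neighbours gives a path of length exactly
-- f v. Hence min f = 0 and max f = L.

open import Defs
open import Data.Nat using (ℕ; _+_; _*_; _≤_)
open import Data.Fin using (Fin)
open import Data.Fin.Permutation using (Permutation′)
open import Data.Product using (_×_; ∃-syntax; proj₁; proj₂)
open import Data.Product using (Σ; _,_)
open import Data.Nat using (zero; suc; _<_; _⊔_; _∸_; s≤s)
open import Data.Nat.Properties hiding (_≟_)
open import Data.Nat.Induction using (<-rec)
open import Data.Nat.ListAction using (sum)
open import Data.Fin as Fin using (toℕ; _≟_)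
import Data.Fin.Permutation as Perm
open import Data.Fin.Permutation using (_⟨$⟩ʳ_; _⟨$⟩ˡ_)
open import Data.List using (List; []; _∷_; length; map; foldl; allFin; tabulate; _∷ʳ_)
open import Data.List.Properties using (map-tabulate)
open import Data.List.Extrema.Nat using (argmin; argmax; f[argmin]≤f[xs]; f[xs]≤f[argmax])
open import Data.List.Membership.Propositional using (_∈_; _∉_)
open import Data.List.Membership.Propositional.Properties using (∈-map⁺; ∈-allFin)
open import Data.List.Relation.Unary.Any using (here; there)
import Data.List.Relation.Unary.All as All
open import Data.List.Relation.Unary.AllPairs as AllPairs using (AllPairs; _∷_)
import Data.List.Relation.Unary.AllPairs.Properties as AllPairsₚ
open import Data.List.Relation.Unary.Linked as Linked using (Linked; [-]; _∷_)
import Data.List.Relation.Unary.Linked.Properties as Linkedₚ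
open import Data.List.Relation.Unary.Unique.Propositional using (Unique)
open import Data.Empty using (⊥-elim)
open import Data.Sum using (_⊎_; inj₁; inj₂)
open import Relation.Nullary using (¬_; yes; no)
open import Relation.Binary.PropositionalEquality
import Algebra.Properties.CommutativeMonoid.Sum as CommutativeMonoidSum
open import Algebra.Properties.CommutativeSemigroup +-commutativeSemigroup using (x∙yz≈y∙xz)
open import Function using (id; _∘_; _∘′_)

private
  variable
    A : Set
    n : ℕ

module FinSum = CommutativeMonoidSum +-0-commutativeMonoid

maxList-map-≤ : (f : A → ℕ) {w : A} (ws : List A) → w ∈ ws → f w ≤ maxList (map f ws)
maxList-map-≤ f (u ∷ us) (here refl) = m≤m⊔n (f u) _
maxList-map-≤ f (u ∷ us) (there w∈) = ≤-trans (maxList-map-≤ f us w∈) (m≤n⊔m (f u) _)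

maxList-map-cong : (f g : A → ℕ) (ws : List A) → (∀ {w} → w ∈ ws → f w ≡ g w) →
                   maxList (map f ws) ≡ maxList (map g ws)
maxList-map-cong f g []       f≗g = refl
maxList-map-cong f g (u ∷ us) f≗g =
  cong₂ _⊔_ (f≗g (here refl)) (maxList-map-cong f g us (f≗g ∘′ there))

maxList-map-attained : (f : A → ℕ) (u : A) (us : List A) →
                       ∃[ w ] (w ∈ u ∷ us × maxList (map f (u ∷ us)) ≡ f w)
maxList-map-attained f u []        = u , here refl , ⊔-identityʳ (f u)
maxList-map-attained f u (u′ ∷ us) with maxList-map-attained f u′ us
... | w , w∈ , max≡fw with ≤-total (f u) (maxList (map f (u′ ∷ us)))
...   | inj₁ fu≤ = w , there w∈ , trans (m≤n⇒m⊔n≡n fu≤) max≡fw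
...   | inj₂ fu≥ = u , here refl , m≥n⇒m⊔n≡m fu≥

∈⇒<newY : (f : Fin n → ℕ) {w : Fin n} (ws : List (Fin n)) → w ∈ ws → f w < newY f ws
∈⇒<newY f (u ∷ us) w∈ = s≤s (maxList-map-≤ f (u ∷ us) w∈)

newY-cong : (f g : Fin n → ℕ) (ws : List (Fin n)) → (∀ {w} → w ∈ ws → f w ≡ g w) →
            newY f ws ≡ newY g ws
newY-cong f g []       f≗g = refl
newY-cong f g (u ∷ us) f≗g = cong suc (maxList-map-cong f g (u ∷ us) f≗g)

newY-zero-or-attained : (f : Fin n → ℕ) (ws : List (Fin n)) →
                        newY f ws ≡ 0 ⊎ ∃[ w ] (w ∈ ws × newY f ws ≡ suc (f w))
newY-zero-or-attained f []       = inj₁ refl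
newY-zero-or-attained f (u ∷ us) with maxList-map-attained f u us
... | w , w∈ , max≡fw = inj₂ (w , w∈ , cong suc max≡fw)

update-same : (tbl : Fin n → ℕ) (v : Fin n) (a : ℕ) → update tbl v a v ≡ a
update-same tbl v a with v ≟ v
... | yes _   = refl
... | no v≢v = ⊥-elim (v≢v refl)

update-other : (tbl : Fin n → ℕ) (v : Fin n) (a : ℕ) {u : Fin n} → ¬ u ≡ v →
               update tbl v a u ≡ tbl u
update-other tbl v a {u} u≢v with u ≟ v
... | yes u≡v = ⊥-elim (u≢v u≡v)
... | no _    = refl

length-∷ʳ : (xs : List A) (a : A) → length (xs ∷ʳ a) ≡ suc (length xs)
length-∷ʳ []       a = refl
length-∷ʳ (x ∷ xs) a = cong suc (length-∷ʳ xs a)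

∷ʳ-nonempty : (xs : List A) (a : A) → ¬ (xs ∷ʳ a ≡ [])
∷ʳ-nonempty []       a ()
∷ʳ-nonempty (x ∷ xs) a ()

Linked-∷ʳ⁺ : {R : A → A → Set} (xs : List A) {a b : A} →
             Linked R (xs ∷ʳ a) → R a b → Linked R (xs ∷ʳ a ∷ʳ b)
Linked-∷ʳ⁺ []           [-]         Rab = Rab ∷ [-]
Linked-∷ʳ⁺ (x ∷ [])     (Rxa ∷ l)   Rab = Rxa ∷ Linked-∷ʳ⁺ [] l Rab
Linked-∷ʳ⁺ (x ∷ y ∷ xs) (Rxy ∷ l)   Rab = Rxy ∷ Linked-∷ʳ⁺ (y ∷ xs) l Rab

module _ (f : A → ℕ) where

  Ascending : A → A → Set
  Ascending a b = f a < f b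

  ascending-climbs : {x : A} {xs : List A} → Linked Ascending (x ∷ xs) →
                     ∃[ u ] (f x + length xs ≤ f u)
  ascending-climbs {x} [-]                  = x , ≤-reflexive (+-identityʳ (f x))
  ascending-climbs {x} {y ∷ ys} (fx<fy ∷ l) with ascending-climbs l
  ... | u , climb = u , (begin
    f x + suc (length ys) ≡⟨ +-suc (f x) (length ys) ⟩
    suc (f x) + length ys ≤⟨ +-monoˡ-≤ (length ys) fx<fy ⟩
    f y + length ys       ≤⟨ climb ⟩
    f u                   ∎)
    where open ≤-Reasoning

  ascending-unique : {xs : List A} → Linked Ascending xs → Unique xs
  ascending-unique l =
    AllPairs.map (λ fx<fy x≡y → <-irrefl (cong f x≡y) fx<fy) (Linkedₚ.Linked⇒AllPairs <-trans l)

Compacted : DAG n → (Fin n → ℕ) → Set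
Compacted {n} G f = ∀ (v : Fin n) → f v ≡ newY f (inc G v)

PathTo : (G : DAG n) → Fin n → ℕ → Set
PathTo {n} G v k = ∃[ xs ] (Linked (Edge G) (xs ∷ʳ v) × length xs ≡ k)

module CompactedProperties (G : DAG n) {f : Fin n → ℕ} (compacted : Compacted G f) where

  edge-ascending : ∀ {w v} → Edge G w v → f w < f v
  edge-ascending {w} {v} w∈ = subst (f w <_) (sym (compacted v)) (∈⇒<newY f (inc G v) w∈)

  path-ascending : ∀ {xs} → Linked (Edge G) xs → Linked (Ascending f) xs
  path-ascending = Linked.map edge-ascending

  pathTo : ∀ v → PathTo G v (f v)
  pathTo v = <-rec (λ k → ∀ v → f v ≡ k → PathTo G v (f v)) step (f v) v refl
    where
      step : ∀ k → (∀ {j} → j < k → ∀ w → f w ≡ j → PathTo G w (f w)) →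
             ∀ v → f v ≡ k → PathTo G v (f v)
      step k rec v refl with newY-zero-or-attained f (inc G v)
      ... | inj₁ newY≡0            = [] , [-] , sym (trans (compacted v) newY≡0)
      ... | inj₂ (w , w∈ , newY≡) with rec (edge-ascending w∈) w refl
      ...   | xs , l , length≡fw   =
        xs ∷ʳ w , Linked-∷ʳ⁺ xs l w∈ ,
        trans (length-∷ʳ xs w) (trans (cong suc length≡fw) (sym (trans (compacted v) newY≡)))

  longestPathTo : ∀ v → Σ (DirectedPath G) λ P → pathLength P ≡ f v
  longestPathTo v with pathTo v
  ... | xs , l , length≡fv =
    record { vertices = xs ∷ʳ v ; nonempty = ∷ʳ-nonempty xs v ; linked = l
           ; simple = ascending-unique f (path-ascending l) } ,
    trans (cong (_∸ 1) (length-∷ʳ xs v)) length≡fv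

  pathLength-≤ : (P : DirectedPath G) → ∃[ u ] (pathLength P ≤ f u)
  pathLength-≤ record { vertices = [] ; nonempty = nonempty } = ⊥-elim (nonempty refl)
  pathLength-≤ record { vertices = x ∷ xs ; linked = l } with ascending-climbs f (path-ascending l)
  ... | u , climb = u , ≤-trans (m≤n+m (length xs) (f x)) climb

  minimum≡0 : ∀ lo → (∀ w → f lo ≤ f w) → f lo ≡ 0
  minimum≡0 lo minimal with newY-zero-or-attained f (inc G lo)
  ... | inj₁ newY≡0          = trans (compacted lo) newY≡0
  ... | inj₂ (w , w∈ , _)    = ⊥-elim (<⇒≱ (edge-ascending w∈) (minimal w))

  height : ∀ L → IsLongestPathLength G L → Height f L
  height L ((P , length≡L) , longest) with pathLength-≤ P
  ... | u , L≤fu = lo , hi , minimal , maximal , sym (begin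
    f hi ∸ f lo ≡⟨ cong (f hi ∸_) (minimum≡0 lo minimal) ⟩
    f hi        ≡⟨ ≤-antisym fhi≤L L≤fhi ⟩
    L           ∎)
    where
      open ≡-Reasoning
      lo hi : Fin n
      lo = argmin f u (allFin n)
      hi = argmax f u (allFin n)
      minimal : ∀ w → f lo ≤ f w
      minimal w = All.lookup (f[argmin]≤f[xs] u (allFin n)) (∈-allFin w)
      maximal : ∀ w → f w ≤ f hi
      maximal w = All.lookup (f[xs]≤f[argmax] u (allFin n)) (∈-allFin w)
      fhi≤L : f hi ≤ L
      fhi≤L = let (Q , length≡fhi) = longestPathTo hi in subst (_≤ L) length≡fhi (longest Q)
      L≤fhi : L ≤ f hi
      L≤fhi = ≤-trans (subst (_≤ f u) length≡L L≤fu) (maximal u)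

module _ (G : DAG n) where

  visits-frame : ∀ s xs {u} → u ∉ xs → proj₁ (foldl (visit G) s xs) u ≡ proj₁ s u
  visits-frame s []       u∉ = refl
  visits-frame s (a ∷ xs) u∉ =
    trans (visits-frame (visit G s a) xs (u∉ ∘ there)) (update-other (proj₁ s) a _ (u∉ ∘ here))

  visits-compacted : (r : Fin n → ℕ) → (∀ {w v} → Edge G w v → r w < r v) →
                     ∀ s xs → AllPairs (Ascending r) xs →
                     ∀ {v} → v ∈ xs →
                     let f = proj₁ (foldl (visit G) s xs) in f v ≡ newY f (inc G v)
  visits-compacted r r-up s (a ∷ xs) (_ ∷ sorted) (there v∈) =
    visits-compacted r r-up (visit G s a) xs sorted v∈
  visits-compacted r r-up s (a ∷ xs) (a<xs ∷ _) (here refl) = begin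
    F a                             ≡⟨ visits-frame (visit G s a) xs a∉xs ⟩
    update T a (newY T (inc G a)) a ≡⟨ update-same T a _ ⟩
    newY T (inc G a)                ≡⟨ newY-cong T F (inc G a) (sym ∘ F≡T) ⟩
    newY F (inc G a)                ∎
    where
      open ≡-Reasoning
      T F : Fin n → ℕ
      T = proj₁ s
      F = proj₁ (foldl (visit G) (visit G s a) xs)
      a∉xs : a ∉ xs
      a∉xs a∈xs = <-irrefl refl (All.lookup a<xs a∈xs)
      F≡T : ∀ {w} → w ∈ inc G a → F w ≡ T w
      F≡T w∈ = trans (visits-frame (visit G s a) xs (λ w∈xs → <-asym (r-up w∈) (All.lookup a<xs w∈xs)))
                     (update-other T a _ (λ w≡a → <-irrefl (cong r w≡a) (r-up w∈)))

  visits-steps : ∀ tbl t xs →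
                 proj₂ (foldl (visit G) (tbl , t) xs) ≡ t + sum (map (λ v → suc (length (inc G v))) xs)
  visits-steps tbl t []       = sym (+-identityʳ t)
  visits-steps tbl t (a ∷ xs) = trans (visits-steps _ _ xs) (+-assoc t _ _)

sum-tabulate : (f : Fin n → ℕ) → sum (tabulate f) ≡ FinSum.sum f
sum-tabulate {zero}  f = refl
sum-tabulate {suc n} f = cong (f Fin.zero +_) (sum-tabulate (f ∘ Fin.suc))

sum-suc : (f : Fin n → ℕ) → FinSum.sum (suc ∘ f) ≡ n + FinSum.sum f
sum-suc {zero}  f = refl
sum-suc {suc n} f = cong suc (begin
  f Fin.zero + FinSum.sum (suc ∘ f ∘ Fin.suc)  ≡⟨ cong (f Fin.zero +_) (sum-suc (f ∘ Fin.suc)) ⟩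
  f Fin.zero + (n + FinSum.sum (f ∘ Fin.suc))  ≡⟨ x∙yz≈y∙xz (f Fin.zero) n _ ⟩
  n + FinSum.sum f                             ∎)
  where open ≡-Reasoning

module _ (π : Permutation′ n) where

  visitOrder-sorted : AllPairs (Ascending (sortY π)) (visitOrder π)
  visitOrder-sorted = AllPairsₚ.map⁺ (AllPairsₚ.tabulate⁺-< ascending)
    where
      ascending : ∀ {i j} → i Fin.< j → toℕ (π ⟨$⟩ʳ (π ⟨$⟩ˡ i)) < toℕ (π ⟨$⟩ʳ (π ⟨$⟩ˡ j))
      ascending {i} {j} i<j rewrite Perm.inverseʳ π {i} | Perm.inverseʳ π {j} = i<j

  visitOrder-complete : ∀ v → v ∈ visitOrder π
  visitOrder-complete v =
    subst (_∈ visitOrder π) (Perm.inverseˡ π) (∈-map⁺ (π ⟨$⟩ˡ_) (∈-allFin (π ⟨$⟩ʳ v)))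

  compact-compacted : (G : DAG n) → (∀ w v → Edge G w v → sortY π w < sortY π v) →
                      Compacted G (proj₁ (compact G π))
  compact-compacted G up v =
    visits-compacted G (sortY π) (up _ _) _ (visitOrder π) visitOrder-sorted (visitOrder-complete v)

  compact-steps : (G : DAG n) → proj₂ (compact G π) ≡ n + edgeCount G
  compact-steps G = begin
    proj₂ (compact G π)                              ≡⟨ visits-steps G _ 0 (visitOrder π) ⟩
    sum (map cost (map (π ⟨$⟩ˡ_) (tabulate id)))    ≡⟨ cong (sum ∘ map cost) (map-tabulate id (π ⟨$⟩ˡ_)) ⟩
    sum (map cost (tabulate (π ⟨$⟩ˡ_)))              ≡⟨ cong sum (map-tabulate (π ⟨$⟩ˡ_) cost) ⟩
    sum (tabulate (cost ∘ (π ⟨$⟩ˡ_)))               ≡⟨ sum-tabulate (cost ∘ (π ⟨$⟩ˡ_)) ⟩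
    FinSum.sum (cost ∘ (π ⟨$⟩ˡ_))                    ≡⟨ FinSum.sum-permute cost (Perm.flip π) ⟨
    FinSum.sum cost                                  ≡⟨ sum-suc inDegree ⟩
    n + FinSum.sum inDegree                          ≡⟨ cong (n +_) (sum-tabulate inDegree) ⟨
    n + sum (tabulate inDegree)                      ≡⟨ cong (λ ds → n + sum ds) (map-tabulate id inDegree) ⟨
    n + edgeCount G                                  ∎
    where
      open ≡-Reasoning
      inDegree cost : Fin n → ℕ
      inDegree v = length (inc G v)
      cost v = suc (inDegree v)

theorem3p3 : ∃[ c ] (∀ (n : ℕ) (G : DAG n) (D : PathDecomposition G)
    (x : Fin n → ℕ) (π : Permutation′ n) →
    IsPathBasedDrawing G D x (sortY π) →
    (proj₂ (compact G π) ≤ c * (n + edgeCount G) + c)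
    × IsPathBasedDrawing G D x (proj₁ (compact G π))
    × (∀ L → IsLongestPathLength G L → Height (proj₁ (compact G π)) L))
theorem3p3 = 1 , λ n G D x π Γ₁ →
  let open IsPathBasedDrawing Γ₁
      open CompactedProperties G (compact-compacted π G upward)
      linear : proj₂ (compact G π) ≤ 1 * (n + edgeCount G) + 1
      linear = begin
        proj₂ (compact G π)    ≡⟨ compact-steps π G ⟩
        n + edgeCount G        ≡⟨ *-identityˡ (n + edgeCount G) ⟨
        1 * (n + edgeCount G)  ≤⟨ m≤m+n _ 1 ⟩
        1 * (n + edgeCount G) + 1 ∎
  in linear , record { x-path = x-path ; upward = λ _ _ → edge-ascending } , height
  where open ≤-Reasoning
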